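{- Let $n \geq 2$ and $v \in A_n$. Then $$\ell_{T(A_n)}(v) = \begin{cases} n - cyc(v) & \text{if } 1,2 \text{ are in different cycles of } v,\\ n - cyc(v) - 1 & \text{if } 1,2 \text{ are in the same cycle of } v.\end{cases}$$
   Context: $A_n$ is the alternating group on $\{1,\dots,n\}$. $cyc(v)$ is the number of cycles in the disjoint cycle decomposition of $v$, with fixed points counted as cycles. Set $T(A_n) = \{(1\,2)(i\,j) \mid 1 \le i<j \le n\}$, a generating set of $A_n$. The length $\ell_{T(A_n)}(v)$ is the minimal $k\ge0$ such that $v$ is a product of $k$ elements of $T(A_n)$. -}

module Defs where

open import Data.Nat using (ℕ; zero; suc; _≤_; _∸_)
open import Data.Fin using (Fin; toℕ) renaming (zero to f0; suc to fs; _<_ to _<ᶠ_; _≤_ to _≤ᶠ_)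
open import Data.Fin.Properties using (_<?_; _≤?_; all?)
open import Data.Fin.Permutation using (Permutation′; _⟨$⟩ʳ_; _∘ₚ_; transpose; id; _≈_)
open import Data.List using (List; []; _∷_; length; filter; allFin; concatMap; map; foldr)
open import Data.List.Relation.Unary.All using (All)
open import Data.Product using (_×_; _,_; ∃; proj₁; proj₂)
open import Relation.Binary.PropositionalEquality using (_≡_)
open import Relation.Nullary using (¬_)
open import Data.Nat.Divisibility using (_∣_)

-- Permutations of {1,…,n} are represented as permutations of Fin n
-- (point 1 ↦ Fin index 0, point 2 ↦ Fin index 1, …).
Perm : ℕ → Set
Perm n = Permutation′ n

_^_$_ : ∀ {n} → Perm n → ℕ → Fin n → Fin n
v ^ zero  $ i = i
v ^ suc k $ i = v ⟨$⟩ʳ (v ^ k $ i)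

allPairs : ∀ n → List (Fin n × Fin n)
allPairs n = concatMap (λ i → map (λ j → (i , j)) (allFin n)) (allFin n)

inversions : ∀ {n} → Perm n → ℕ
inversions {n} v =
  length (filter (λ p → proj₁ p <? proj₂ p) (filter (λ p → (v ⟨$⟩ʳ proj₂ p) <? (v ⟨$⟩ʳ proj₁ p)) (allPairs n)))

InAlt : ∀ {n} → Perm n → Set
InAlt v = 2 ∣ inversions v

-- i is the smallest element of its cycle under v.  Since every cycle
-- has length ≤ n, the cycle of i is {v^k(i) | 0 ≤ k < n}.
IsCycleMin : ∀ {n} → Perm n → Fin n → Set
IsCycleMin {n} v i = ∀ (k : Fin n) → i ≤ᶠ (v ^ toℕ k $ i)

-- cyc(v): number of cycles (fixed points included) = number of cycle minima
cyc : ∀ {n} → Perm n → ℕ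
cyc {n} v = length (filter (λ i → all? {n = n} (λ k → i ≤? (v ^ toℕ k $ i))) (allFin n))

SameCycle : ∀ {n} → Perm n → Fin n → Fin n → Set
SameCycle v i j = ∃ λ k → v ^ k $ i ≡ j

gen : ∀ {m} → Fin (suc (suc m)) → Fin (suc (suc m)) → Perm (suc (suc m))
gen i j = transpose f0 (fs f0) ∘ₚ transpose i j

prod : ∀ {m} → List (Fin (suc (suc m)) × Fin (suc (suc m))) → Perm (suc (suc m))
prod = foldr (λ p acc → gen (proj₁ p) (proj₂ p) ∘ₚ acc) id

ProductOfT : ∀ {m} → Perm (suc (suc m)) → ℕ → Set
ProductOfT v k = ∃ λ w → length w ≡ k × All (λ p → proj₁ p <ᶠ proj₂ p) w × prod w ≈ v

LengthT : ∀ {m} → Perm (suc (suc m)) → ℕ → Set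
LengthT v k = ProductOfT v k × (∀ k′ → ProductOfT v k′ → k ≤ k′)

module Submission where

-- Put D v = cyc v + [1 and 2 lie in the same cycle of v].  The theorem says
-- ℓ(v) = n ∸ D v.  Everything rests on one classical fact (the dichotomy
-- below): composing v with a transposition (a b) joins the cycles of a and
-- b if they are distinct and splits their common cycle otherwise, so cyc
-- changes by exactly one.  From it we get
--   * parity: removing an adjacent descent lowers the inversion count by
--     one, hence inversions v + cyc v ≡ n (mod 2), and an even v has
--     cyc v ≡ n (mod 2);
--   * lower bound: (1 2) preserves D and any (i j) lowers D by at most one,
--     so a generator changes D by at most one; as D(id) = n, every word for
--     v has length at least n ∸ D v;
--   * upper bound: while D v < n, splitting a suitable point off its cycle
--     raises D by one, and the parity of cyc excludes the one stuck case
--     (D v = n with 1, 2 linked), so v is a word of length n ∸ D v.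

open import Defs
open import Data.Nat using (ℕ; zero; suc; _+_; _*_; _∸_; z≤n; s≤s; _%_; _/_; parity) renaming (_≤_ to _≤ℕ_; _<_ to _<ℕ_)
import Data.Nat.Properties as NP
open import Data.Fin using (Fin; toℕ; fromℕ<) renaming (zero to f0; suc to fs; _<_ to _<ᶠ_; _≤_ to _≤ᶠ_)
import Data.Fin.Properties as FP
open import Data.Nat.DivMod using (m≡m%n+[m/n]*n; m%n<n)
open import Data.Fin.Permutation using (_⟨$⟩ʳ_; _⟨$⟩ˡ_; _∘ₚ_; transpose; id; _≈_; inverseʳ)
import Data.Fin.Permutation.Components as PC
open import Data.List.Relation.Unary.All using (All; []; _∷_)
open import Data.List using (List; []; _∷_; length; filter; tabulate; foldr; map; concatMap; allFin; _++_)
open import Data.Product using (_×_; _,_; ∃; proj₁; proj₂)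
open import Data.Sum using (_⊎_; inj₁; inj₂; swap)
open import Relation.Binary.Definitions using (tri<; tri≈; tri>)
open import Data.Empty using (⊥-elim)
open import Function.Bundles using (Injection)
open import Function.Properties.Inverse using (↔⇒↣)
open import Relation.Binary.PropositionalEquality using (_≡_; _≢_; refl; sym; trans; cong; cong₂; subst; subst₂; module ≡-Reasoning)
open import Relation.Nullary using (¬_; Dec; yes; no)
open import Relation.Nullary.Decidable using (map′; _⊎-dec_; _×-dec_; ¬?; decidable-stable)
open import Data.Nat.Divisibility using (divides)
open import Data.Parity using (_⁻¹)
open import Data.Parity.Properties using (⁻¹-selfInverse; ⁻¹-involutive; p≢p⁻¹; suc-homo-⁻¹)
open import Algebra.Properties.CommutativeMonoid.Sum NP.+-0-commutativeMonoid
  using (sum; sum-cong-≗; sum-replicate-zero; ∑-distrib-+; sum-permute; sum-remove)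
open import Algebra.Properties.Semiring.Sum NP.+-*-semiring using (*-distribˡ-sum)
open import Data.Vec.Functional using (removeAt)

open ≡-Reasoning

-- The indicator (0 or 1) of a decided proposition; cycle counts and
-- inversion counts are handled as sums of indicators over Fin n.
ind : ∀ {p} {P : Set p} → Dec P → ℕ
ind (yes _) = 1
ind (no _)  = 0

ind≤1 : ∀ {p} {P : Set p} (d : Dec P) → ind d ≤ℕ 1
ind≤1 (yes _) = s≤s z≤n
ind≤1 (no _)  = z≤n

ind-yes : ∀ {p} {P : Set p} (d : Dec P) → P → ind d ≡ 1
ind-yes (yes _) _  = refl
ind-yes (no ¬p) p  = ⊥-elim (¬p p)

ind-no : ∀ {p} {P : Set p} (d : Dec P) → ¬ P → ind d ≡ 0
ind-no (yes p) ¬p = ⊥-elim (¬p p)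
ind-no (no _)  _  = refl

ind-true : ∀ {p} {P : Set p} (d : Dec P) → ind d ≡ 1 → P
ind-true (yes p) _ = p

ind-⇔ : ∀ {p q} {P : Set p} {Q : Set q} (d : Dec P) (e : Dec Q) → (P → Q) → (Q → P) → ind d ≡ ind e
ind-⇔ (yes _) (yes _) _ _ = refl
ind-⇔ (yes p) (no ¬q) f _ = ⊥-elim (¬q (f p))
ind-⇔ (no ¬p) (yes q) _ g = ⊥-elim (¬p (g q))
ind-⇔ (no _)  (no _)  _ _ = refl

ind-mono : ∀ {p q} {P : Set p} {Q : Set q} (d : Dec P) (e : Dec Q) → (P → Q) → ind d ≤ℕ ind e
ind-mono (yes p) e f = NP.≤-reflexive (sym (ind-yes e (f p)))
ind-mono (no _)  e f = z≤n

length-filter-tabulate : ∀ {a p} {A : Set a} {P : A → Set p} (P? : ∀ x → Dec (P x)) {n} (f : Fin n → A) →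
  length (filter P? (tabulate f)) ≡ sum (λ i → ind (P? (f i)))
length-filter-tabulate P? {zero}  f = refl
length-filter-tabulate P? {suc n} f with P? (f f0)
... | yes _ = cong suc (length-filter-tabulate P? (λ i → f (fs i)))
... | no _  = length-filter-tabulate P? (λ i → f (fs i))

sum-mono : ∀ {n} {f g : Fin n → ℕ} → (∀ i → f i ≤ℕ g i) → sum f ≤ℕ sum g
sum-mono {zero}  _  = z≤n
sum-mono {suc n} le = NP.+-mono-≤ (le f0) (sum-mono (λ i → le (fs i)))

sum-ones : ∀ n → sum {n} (λ _ → 1) ≡ n
sum-ones zero    = refl
sum-ones (suc n) = cong suc (sum-ones n)

sum-zeros : ∀ {n} {f : Fin n → ℕ} → (∀ i → f i ≡ 0) → sum f ≡ 0
sum-zeros {n} e = trans (sum-cong-≗ e) (sum-replicate-zero n)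

sum-≤1 : ∀ {n} (f : Fin n → ℕ) → (∀ i → f i ≤ℕ 1) → sum f ≤ℕ n
sum-≤1 {n} f le = subst (sum f ≤ℕ_) (sum-ones n) (sum-mono le)

sum-≤1-missing : ∀ {n} (f : Fin (suc n) → ℕ) → (∀ i → f i ≤ℕ 1) → ∀ c → f c ≡ 0 → sum f ≤ℕ n
sum-≤1-missing {n} f le c fc≡0 = subst (_≤ℕ n) (sym (trans (sum-remove {i = c} f) (cong (_+ sum (removeAt f c)) fc≡0)))
  (sum-≤1 (removeAt f c) (λ i → le _))

sum-δ : ∀ {n} (c : Fin n) → sum (λ i → ind (i FP.≟ c)) ≡ 1
sum-δ {suc n} f0     = cong suc (sum-zeros {n} (λ i → ind-no (fs i FP.≟ f0) (λ ())))
sum-δ {suc n} (fs c) = begin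
  ind (f0 FP.≟ fs c) + sum (λ i → ind (fs i FP.≟ fs c))
    ≡⟨ cong₂ _+_ (ind-no (f0 FP.≟ fs c) (λ ())) (sum-cong-≗ (λ i → ind-⇔ (fs i FP.≟ fs c) (i FP.≟ c) FP.suc-injective (cong fs))) ⟩
  sum (λ i → ind (i FP.≟ c))
    ≡⟨ sum-δ c ⟩
  1 ∎

sum-mono-tight : ∀ {n} {f g : Fin n → ℕ} → (∀ i → f i ≤ℕ g i) → sum f ≡ sum g → ∀ i → f i ≡ g i
sum-mono-tight {suc n} {f} {g} le eq f0 = NP.≤-antisym (le f0)
  (NP.+-cancelʳ-≤ (sum (λ i → f (fs i))) (g f0) (f f0)
    (NP.≤-trans (NP.+-monoʳ-≤ (g f0) (sum-mono (λ i → le (fs i)))) (NP.≤-reflexive (sym eq))))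
sum-mono-tight {suc n} {f} {g} le eq (fs i) = sum-mono-tight (λ j → le (fs j)) tailEq i
  where
  tailEq : sum (λ j → f (fs j)) ≡ sum (λ j → g (fs j))
  tailEq = NP.≤-antisym (sum-mono (λ j → le (fs j)))
    (NP.+-cancelˡ-≤ (f f0) _ _ (NP.≤-trans (NP.+-monoˡ-≤ _ (le f0)) (NP.≤-reflexive (sym eq))))

least-ℕ : (P : ℕ → Set) → (∀ k → Dec (P k)) → ∀ k → P k → ∃ λ k′ → P k′ × (∀ j → j <ℕ k′ → ¬ P j)
least-ℕ P P? k pk with P? 0
... | yes p0 = 0 , p0 , (λ j ())
least-ℕ P P? zero    pk | no ¬p0 = ⊥-elim (¬p0 pk)
least-ℕ P P? (suc k) pk | no ¬p0 with least-ℕ (λ j → P (suc j)) (λ j → P? (suc j)) k pk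
... | k′ , pk′ , below = suc k′ , pk′ , below′
  where
  below′ : ∀ j → j <ℕ suc k′ → ¬ P j
  below′ zero    _       = ¬p0
  below′ (suc j) (s≤s j<) = below j j<

least-Fin : ∀ {n} (P : Fin n → Set) → (∀ i → Dec (P i)) → ∀ x → P x → ∃ λ m → P m × (∀ j → P j → m ≤ᶠ j)
least-Fin {suc n} P P? x px with P? f0
... | yes p0 = f0 , p0 , (λ _ _ → z≤n)
least-Fin {suc n} P P? f0     px | no ¬p0 = ⊥-elim (¬p0 px)
least-Fin {suc n} P P? (fs x) px | no ¬p0 with least-Fin (λ i → P (fs i)) (λ i → P? (fs i)) x px
... | m , pm , below = fs m , pm , below′
  where
  below′ : ∀ j → P j → fs m ≤ᶠ j
  below′ f0     pj = ⊥-elim (¬p0 pj)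
  below′ (fs j) pj = s≤s (below j pj)

perm-injective : ∀ {n} (v : Perm n) {x y} → v ⟨$⟩ʳ x ≡ v ⟨$⟩ʳ y → x ≡ y
perm-injective v = Injection.injective (↔⇒↣ v)

iter-+ : ∀ {n} (v : Perm n) j k x → v ^ (j + k) $ x ≡ v ^ j $ (v ^ k $ x)
iter-+ v zero    k x = refl
iter-+ v (suc j) k x = cong (v ⟨$⟩ʳ_) (iter-+ v j k x)

iter-injective : ∀ {n} (v : Perm n) k {x y} → v ^ k $ x ≡ v ^ k $ y → x ≡ y
iter-injective v zero    e = e
iter-injective v (suc k) e = iter-injective v k (perm-injective v e)

iter-cong : ∀ {n} {v w : Perm n} → v ≈ w → ∀ k x → v ^ k $ x ≡ w ^ k $ x
iter-cong e zero    x = refl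
iter-cong {v = v} e (suc k) x = trans (cong (v ⟨$⟩ʳ_) (iter-cong e k x)) (e _)

iter-fixed : ∀ {n} (v : Perm n) {x} → v ⟨$⟩ʳ x ≡ x → ∀ k → v ^ k $ x ≡ x
iter-fixed v e zero    = refl
iter-fixed v e (suc k) = trans (cong (v ⟨$⟩ʳ_) (iter-fixed v e k)) e

-- Every point returns to itself after some number 1 + p ≤ n of steps
-- (pigeonhole on x, v x, …, vⁿ x).
period : ∀ {n} (v : Perm n) x → ∃ λ p → (suc p ≤ℕ n) × (v ^ suc p $ x ≡ x)
period {n} v x with FP.pigeonhole (NP.n<1+n n) (λ (i : Fin (suc n)) → v ^ toℕ i $ x)
... | i , j , i<j , collide with NP.m≤n⇒∃[o]m+o≡n i<j
... | p , i+1+p≡j = p , bound , iter-injective v (toℕ i) back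
  where
  i+[1+p]≡j : toℕ i + suc p ≡ toℕ j
  i+[1+p]≡j = trans (NP.+-suc (toℕ i) p) i+1+p≡j
  back : v ^ toℕ i $ (v ^ suc p $ x) ≡ v ^ toℕ i $ x
  back = begin
    v ^ toℕ i $ (v ^ suc p $ x) ≡⟨ sym (iter-+ v (toℕ i) (suc p) x) ⟩
    v ^ (toℕ i + suc p) $ x     ≡⟨ cong (λ k → v ^ k $ x) i+[1+p]≡j ⟩
    v ^ toℕ j $ x               ≡⟨ sym collide ⟩
    v ^ toℕ i $ x               ∎
  bound : suc p ≤ℕ n
  bound = NP.≤-trans (NP.m≤n+m (suc p) (toℕ i))
            (NP.≤-trans (NP.≤-reflexive i+[1+p]≡j) (NP.≤-pred (FP.toℕ<n j)))

iter-mod : ∀ {n} (v : Perm n) {x} p → v ^ suc p $ x ≡ x → ∀ k → v ^ (k % suc p) $ x ≡ v ^ k $ x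
iter-mod v {x} p ret k = begin
  v ^ (k % d) $ x                         ≡⟨ cong (v ^ (k % d) $_) (sym (multiple (k / d))) ⟩
  v ^ (k % d) $ (v ^ ((k / d) * d) $ x)   ≡⟨ sym (iter-+ v (k % d) ((k / d) * d) x) ⟩
  v ^ (k % d + (k / d) * d) $ x           ≡⟨ cong (λ t → v ^ t $ x) (sym (m≡m%n+[m/n]*n k d)) ⟩
  v ^ k $ x                               ∎
  where
  d = suc p
  multiple : ∀ q → v ^ (q * d) $ x ≡ x
  multiple zero    = refl
  multiple (suc q) = trans (iter-+ v d (q * d) x) (trans (cong (v ^ d $_) (multiple q)) ret)

-- SameCycle v is an equivalence relation, and it is decidable because
-- every cycle is reached within n steps.

sameCycle-refl : ∀ {n} (v : Perm n) x → SameCycle v x x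
sameCycle-refl v x = 0 , refl

sameCycle-step : ∀ {n} (v : Perm n) x → SameCycle v x (v ⟨$⟩ʳ x)
sameCycle-step v x = 1 , refl

sameCycle-trans : ∀ {n} (v : Perm n) {x y z} → SameCycle v x y → SameCycle v y z → SameCycle v x z
sameCycle-trans v {x} (j , p) (k , q) = k + j , trans (iter-+ v k j x) (trans (cong (v ^ k $_) p) q)

sameCycle-sym : ∀ {n} (v : Perm n) {x y} → SameCycle v x y → SameCycle v y x
sameCycle-sym v {x} (k , refl) with period v x
... | p , _ , ret = suc p ∸ r , (begin
  v ^ (suc p ∸ r) $ (v ^ k $ x)  ≡⟨ cong (v ^ (suc p ∸ r) $_) (sym (iter-mod v p ret k)) ⟩
  v ^ (suc p ∸ r) $ (v ^ r $ x)  ≡⟨ sym (iter-+ v (suc p ∸ r) r x) ⟩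
  v ^ (suc p ∸ r + r) $ x        ≡⟨ cong (λ t → v ^ t $ x) (NP.m∸n+n≡m (NP.<⇒≤ (m%n<n k (suc p)))) ⟩
  v ^ suc p $ x                  ≡⟨ ret ⟩
  x                              ∎)
  where r = k % suc p

sameCycle-bounded : ∀ {n} (v : Perm n) {x y} → SameCycle v x y → ∃ λ (k : Fin n) → v ^ toℕ k $ x ≡ y
sameCycle-bounded v {x} (k , refl) with period v x
... | p , p<n , ret = fromℕ< r<n , trans (cong (λ t → v ^ t $ x) (FP.toℕ-fromℕ< r<n)) (iter-mod v p ret k)
  where r<n = NP.≤-trans (m%n<n k (suc p)) p<n

sameCycle? : ∀ {n} (v : Perm n) x y → Dec (SameCycle v x y)
sameCycle? v x y with FP.any? (λ k → v ^ toℕ k $ x FP.≟ y)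
... | yes (k , e) = yes (toℕ k , e)
... | no ¬e       = no (λ c → ¬e (sameCycle-bounded v c))

sameCycle-cong : ∀ {n} {v w : Perm n} → v ≈ w → ∀ {x y} → SameCycle v x y → SameCycle w x y
sameCycle-cong e {x} (k , c) = k , trans (sym (iter-cong e k x)) c

sameCycle-fixed : ∀ {n} (v : Perm n) {x} → v ⟨$⟩ʳ x ≡ x → ∀ {y} → SameCycle v x y → x ≡ y
sameCycle-fixed v fx (k , c) = trans (sym (iter-fixed v fx k)) c

sameCycle-least : ∀ {n} (v : Perm n) (R : Fin n → Fin n → Set) →
  (∀ x → R x x) → (∀ {x y z} → R x y → R y z → R x z) → (∀ x → R x (v ⟨$⟩ʳ x)) →
  ∀ {x y} → SameCycle v x y → R x y
sameCycle-least v R refl′ trans′ step {x} (k , refl) = walk k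
  where
  walk : ∀ k → R x (v ^ k $ x)
  walk zero    = refl′ x
  walk (suc k) = trans′ (walk k) (step _)

-- i is the least point of its cycle.  Defs counts cycles through
-- IsCycleMin, which only inspects the first n iterates; by
-- sameCycle-bounded the two notions agree.
IsMin : ∀ {n} → Perm n → Fin n → Set
IsMin v i = ∀ j → SameCycle v i j → i ≤ᶠ j

firstIterates⇒IsMin : ∀ {n} (v : Perm n) i → (∀ (k : Fin n) → i ≤ᶠ (v ^ toℕ k $ i)) → IsMin v i
firstIterates⇒IsMin v i c j sc with sameCycle-bounded v sc
... | k , e = subst (i ≤ᶠ_) e (c k)

isMin? : ∀ {n} (v : Perm n) i → Dec (IsMin v i)
isMin? v i = map′ (firstIterates⇒IsMin v i) (λ m k → m _ (toℕ k , refl)) (FP.all? (λ k → i FP.≤? (v ^ toℕ k $ i)))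

cyc-sum : ∀ {n} (v : Perm n) → cyc v ≡ sum (λ i → ind (isMin? v i))
cyc-sum v = trans (length-filter-tabulate (λ i → FP.all? (λ k → i FP.≤? (v ^ toℕ k $ i))) (λ i → i))
  (sum-cong-≗ (λ i → ind-⇔ _ (isMin? v i) (firstIterates⇒IsMin v i) (λ m k → m _ (toℕ k , refl))))

cyc-cong-min : ∀ {n} (v w : Perm n) → (∀ i → IsMin v i → IsMin w i) → (∀ i → IsMin w i → IsMin v i) → cyc v ≡ cyc w
cyc-cong-min v w f g = trans (cyc-sum v) (trans (sum-cong-≗ (λ i → ind-⇔ (isMin? v i) (isMin? w i) (f i) (g i))) (sym (cyc-sum w)))

cyc-cong : ∀ {n} {v w : Perm n} → v ≈ w → cyc v ≡ cyc w
cyc-cong {v = v} {w} e = cyc-cong-min v w (λ i m j c → m j (sameCycle-cong (λ x → sym (e x)) c)) (λ i m j c → m j (sameCycle-cong e c))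

cyc≤n : ∀ {n} (v : Perm n) → cyc v ≤ℕ n
cyc≤n v = subst (_≤ℕ _) (sym (cyc-sum v)) (sum-≤1 _ (λ i → ind≤1 (isMin? v i)))

cyc<n : ∀ {n} (v : Perm (suc n)) x → ¬ IsMin v x → cyc v ≤ℕ n
cyc<n {n} v x notMin = subst (_≤ℕ n) (sym (cyc-sum v)) (sum-≤1-missing _ (λ i → ind≤1 (isMin? v i)) x (ind-no (isMin? v x) notMin))

cyc-identity : ∀ {n} (v : Perm n) → (∀ x → v ⟨$⟩ʳ x ≡ x) → cyc v ≡ n
cyc-identity {n} v fixed = trans (cyc-sum v)
  (trans (sum-cong-≗ (λ i → ind-yes (isMin? v i) (λ j c → FP.≤-reflexive (sameCycle-fixed v (fixed i) c))))
         (sum-ones n))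

cyc≡n⇒identity : ∀ {n} (v : Perm n) → cyc v ≡ n → ∀ x → v ⟨$⟩ʳ x ≡ x
cyc≡n⇒identity {n} v e x = sym (FP.≤-antisym (allMin x _ (sameCycle-step v x)) (allMin (v ⟨$⟩ʳ x) x (sameCycle-sym v (sameCycle-step v x))))
  where
  allMin : ∀ i → IsMin v i
  allMin i = ind-true (isMin? v i)
    (sum-mono-tight (λ i → ind≤1 (isMin? v i)) (trans (sym (cyc-sum v)) (trans e (sym (sum-ones n)))) i)

cycleMin : ∀ {n} (v : Perm n) x → ∃ λ m → SameCycle v x m × IsMin v m
cycleMin v x with least-Fin (SameCycle v x) (sameCycle? v x) x (sameCycle-refl v x)
... | m , xm , least = m , xm , (λ j mj → least j (sameCycle-trans v xm mj))

isMin-unique : ∀ {n} (v : Perm n) {i j} → IsMin v i → IsMin v j → SameCycle v i j → i ≡ j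
isMin-unique v mi mj c = FP.≤-antisym (mi _ c) (mj _ (sameCycle-sym v c))

tr : ∀ {n} → Fin n → Fin n → Fin n → Fin n
tr a b y = transpose a b ⟨$⟩ʳ y

tr-a : ∀ {n} (a b : Fin n) → tr a b a ≡ b
tr-a a b with a FP.≟ a
... | yes _  = refl
... | no ¬p = ⊥-elim (¬p refl)

tr-b : ∀ {n} (a b : Fin n) → tr a b b ≡ a
tr-b a b with b FP.≟ a
... | yes refl = refl
... | no _ with b FP.≟ b
...   | yes _  = refl
...   | no ¬p = ⊥-elim (¬p refl)

tr-other : ∀ {n} (a b y : Fin n) → y ≢ a → y ≢ b → tr a b y ≡ y
tr-other a b y y≢a y≢b with y FP.≟ a
... | yes e = ⊥-elim (y≢a e)
... | no _ with y FP.≟ b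
...   | yes e = ⊥-elim (y≢b e)
...   | no _  = refl

tr-sym : ∀ {n} (a b y : Fin n) → tr a b y ≡ tr b a y
tr-sym a b y = byCases (y FP.≟ a) (y FP.≟ b)
  where
  byCases : Dec (y ≡ a) → Dec (y ≡ b) → tr a b y ≡ tr b a y
  byCases (yes refl) (yes refl) = refl
  byCases (yes refl) (no _)     = trans (tr-a y b) (sym (tr-b b y))
  byCases (no _)     (yes refl) = trans (tr-b a y) (sym (tr-a y a))
  byCases (no y≢a)   (no y≢b)   = trans (tr-other a b y y≢a y≢b) (sym (tr-other b a y y≢b y≢a))

tr-involutive : ∀ {n} (a b y : Fin n) → tr a b (tr a b y) ≡ y
tr-involutive a b y = trans (cong (tr a b) (tr-sym a b y)) (PC.transpose-inverse a b)

ordered-transposition : ∀ {n} {x y : Fin n} → x ≢ y → ∃ λ i → ∃ λ j → i <ᶠ j × transpose i j ≈ transpose x y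
ordered-transposition {x = x} {y} x≢y with FP.<-cmp x y
... | tri< x<y _ _ = x , y , x<y , (λ _ → refl)
... | tri≈ _ e _   = ⊥-elim (x≢y e)
... | tri> _ _ y<x = y , x , y<x , (λ z → tr-sym y x z)

Touches : ∀ {n} → Perm n → Fin n → Fin n → Fin n → Set
Touches v a b z = SameCycle v z a ⊎ SameCycle v z b

record Joins {n} (v u : Perm n) (a b : Fin n) : Set where
  field
    apart    : ¬ SameCycle v a b
    together : SameCycle u a b
    coarser  : ∀ {x y} → SameCycle v x y → SameCycle u x y
    onlyJoin : ∀ {x y} → SameCycle u x y → SameCycle v x y ⊎ (Touches v a b x × Touches v a b y)
    cyc-join : cyc v ≡ suc (cyc u)

-- The effect of composing v with a transposition: u x = v ((a b) x).
module Surgery {n} (v u : Perm n) (a b : Fin n) (a≢b : a ≢ b) (u≈ : u ≈ transpose a b ∘ₚ v) where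

  u-a : u ⟨$⟩ʳ a ≡ v ⟨$⟩ʳ b
  u-a = trans (u≈ a) (cong (v ⟨$⟩ʳ_) (tr-a a b))

  u-b : u ⟨$⟩ʳ b ≡ v ⟨$⟩ʳ a
  u-b = trans (u≈ b) (cong (v ⟨$⟩ʳ_) (tr-b a b))

  u-other : ∀ {y} → y ≢ a → y ≢ b → u ⟨$⟩ʳ y ≡ v ⟨$⟩ʳ y
  u-other {y} y≢a y≢b = trans (u≈ y) (cong (v ⟨$⟩ʳ_) (tr-other a b y y≢a y≢b))

  vb : Fin n
  vb = v ⟨$⟩ʳ b

  IsAB : Fin n → Set
  IsAB y = y ≡ a ⊎ y ≡ b

  -- The v-path vb, v vb, v² vb, … returns to b, so there is a first
  -- index k at which it lies in {a, b}; up to there, u follows the path.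
  firstHit : ∃ λ k → IsAB (v ^ k $ vb) × (∀ j → j <ℕ k → ¬ IsAB (v ^ j $ vb))
  firstHit with sameCycle-sym v (sameCycle-step v b)
  ... | k₀ , back = least-ℕ (λ k → IsAB (v ^ k $ vb)) (λ k → (v ^ k $ vb FP.≟ a) ⊎-dec (v ^ k $ vb FP.≟ b)) k₀ (inj₂ back)

  k : ℕ
  k = proj₁ firstHit

  avoid : ∀ j → j <ℕ k → ¬ IsAB (v ^ j $ vb)
  avoid = proj₂ (proj₂ firstHit)

  path : ∀ j → j ≤ℕ k → u ^ suc j $ a ≡ v ^ j $ vb
  path zero    _   = u-a
  path (suc j) j<k = trans (cong (u ⟨$⟩ʳ_) (path j (NP.<⇒≤ j<k)))
                           (u-other (λ e → avoid j j<k (inj₁ e)) (λ e → avoid j j<k (inj₂ e)))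

  hitA⇒together : v ^ k $ vb ≡ a → SameCycle v b a
  hitA⇒together e = k + 1 , trans (iter-+ v k 1 b) e

  -- Separate cycles are joined: the u-orbit of a runs along the path to b.
  joined : ¬ SameCycle v a b → SameCycle u a b
  joined apart with proj₁ (proj₂ firstHit)
  ... | inj₁ e = ⊥-elim (apart (sameCycle-sym v (hitA⇒together e)))
  ... | inj₂ e = suc k , trans (path k NP.≤-refl) e

  -- A common cycle is split: the u-orbit of a closes up before reaching b.
  separated : SameCycle v a b → ¬ SameCycle u a b
  separated ab with proj₁ (proj₂ firstHit)
  ... | inj₂ e = ⊥-elim (aBeforeB (sameCycle-trans v (sameCycle-sym v (sameCycle-step v b)) (sameCycle-sym v ab)))
    where
    -- the path returns to b after k steps, so every point of the cycle of
    -- b (a in particular) already occurs among its first k points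
    aBeforeB : ¬ SameCycle v vb a
    aBeforeB (m , am) with NP.m≤n⇒m<n∨m≡n (NP.≤-pred (m%n<n m (suc k)))
    ... | inj₁ r<k = avoid (m % suc k) r<k (inj₁ (trans (iter-mod v k (cong (v ⟨$⟩ʳ_) e) m) am))
    ... | inj₂ r≡k = a≢b (trans (sym (trans (iter-mod v k (cong (v ⟨$⟩ʳ_) e) m) am)) (trans (cong (λ t → v ^ t $ vb) r≡k) e))
  ... | inj₁ e = λ { (m , am≡b) → notB (m % suc k) (NP.≤-pred (m%n<n m (suc k))) (trans (iter-mod u k returns m) am≡b) }
    where
    returns : u ^ suc k $ a ≡ a
    returns = trans (path k NP.≤-refl) e
    notB : ∀ r → r ≤ℕ k → u ^ r $ a ≢ b
    notB zero    _       = a≢b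
    notB (suc j) j<k       = λ e′ → avoid j j<k (inj₂ (trans (sym (path j (NP.<⇒≤ j<k))) e′))

  module Join (apart : ¬ SameCycle v a b) where

    together : SameCycle u a b
    together = joined apart

    v-step : ∀ x → SameCycle u x (v ⟨$⟩ʳ x)
    v-step x with x FP.≟ a | x FP.≟ b
    ... | yes refl | _        = sameCycle-trans u together (subst (SameCycle u b) u-b (sameCycle-step u b))
    ... | no _     | yes refl = sameCycle-trans u (sameCycle-sym u together) (subst (SameCycle u a) u-a (sameCycle-step u a))
    ... | no x≢a   | no x≢b   = subst (SameCycle u x) (u-other x≢a x≢b) (sameCycle-step u x)

    coarser : ∀ {x y} → SameCycle v x y → SameCycle u x y
    coarser = sameCycle-least v (SameCycle u) (sameCycle-refl u) (sameCycle-trans u) v-step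

    -- The relation whose classes are the u-cycles: same v-cycle, or both
    -- in the union of the cycles of a and b.
    Merged : Fin n → Fin n → Set
    Merged x y = SameCycle v x y ⊎ (Touches v a b x × Touches v a b y)

    touches-back : ∀ {x y} → SameCycle v x y → Touches v a b y → Touches v a b x
    touches-back c (inj₁ ya) = inj₁ (sameCycle-trans v c ya)
    touches-back c (inj₂ yb) = inj₂ (sameCycle-trans v c yb)

    merged-trans : ∀ {x y z} → Merged x y → Merged y z → Merged x z
    merged-trans (inj₁ xy)        (inj₁ yz)        = inj₁ (sameCycle-trans v xy yz)
    merged-trans (inj₁ xy)        (inj₂ (ty , tz)) = inj₂ (touches-back xy ty , tz)
    merged-trans (inj₂ (tx , ty)) (inj₁ yz)        = inj₂ (tx , touches-back (sameCycle-sym v yz) ty)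
    merged-trans (inj₂ (tx , _))  (inj₂ (_ , tz))  = inj₂ (tx , tz)

    u-step : ∀ x → Merged x (u ⟨$⟩ʳ x)
    u-step x with x FP.≟ a | x FP.≟ b
    ... | yes refl | _        = inj₂ (inj₁ (sameCycle-refl v a) , subst (Touches v a b) (sym u-a) (inj₂ (sameCycle-sym v (sameCycle-step v b))))
    ... | no _     | yes refl = inj₂ (inj₂ (sameCycle-refl v b) , subst (Touches v a b) (sym u-b) (inj₁ (sameCycle-sym v (sameCycle-step v a))))
    ... | no x≢a   | no x≢b   = inj₁ (subst (SameCycle v x) (sym (u-other x≢a x≢b)) (sameCycle-step v x))

    onlyJoin : ∀ {x y} → SameCycle u x y → Merged x y
    onlyJoin = sameCycle-least u Merged (λ x → inj₁ (sameCycle-refl v x)) merged-trans u-step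

    touches⇒sameCycle-a : ∀ {z} → Touches v a b z → SameCycle u z a
    touches⇒sameCycle-a (inj₁ za) = coarser za
    touches⇒sameCycle-a (inj₂ zb) = sameCycle-trans u (coarser zb) (sameCycle-sym u together)

    merged⇒sameCycle : ∀ {x y} → Merged x y → SameCycle u x y
    merged⇒sameCycle (inj₁ xy)        = coarser xy
    merged⇒sameCycle (inj₂ (tx , ty)) = sameCycle-trans u (touches⇒sameCycle-a tx) (sameCycle-sym u (touches⇒sameCycle-a ty))

    ma mb : Fin n
    ma = proj₁ (cycleMin v a)
    mb = proj₁ (cycleMin v b)

    a~ma : SameCycle v a ma
    a~ma = proj₁ (proj₂ (cycleMin v a))

    b~mb : SameCycle v b mb
    b~mb = proj₁ (proj₂ (cycleMin v b))

    ma-min : IsMin v ma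
    ma-min = proj₂ (proj₂ (cycleMin v a))

    mb-min : IsMin v mb
    mb-min = proj₂ (proj₂ (cycleMin v b))

    ma-least : ∀ j → SameCycle v j a → ma ≤ᶠ j
    ma-least j c = ma-min j (sameCycle-sym v (sameCycle-trans v c a~ma))

    mb-least : ∀ j → SameCycle v j b → mb ≤ᶠ j
    mb-least j c = mb-min j (sameCycle-sym v (sameCycle-trans v c b~mb))

    touching-min : ∀ i → IsMin v i → Touches v a b i → i ≡ ma ⊎ i ≡ mb
    touching-min i mi (inj₁ c) = inj₁ (isMin-unique v mi ma-min (sameCycle-trans v c a~ma))
    touching-min i mi (inj₂ c) = inj₂ (isMin-unique v mi mb-min (sameCycle-trans v c b~mb))

    ma≢mb : ma ≢ mb
    ma≢mb e = apart (sameCycle-trans v a~ma (subst (λ t → SameCycle v t b) (sym e) (sameCycle-sym v b~mb)))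

    -- Of the two minima, the larger one hi stops being a cycle minimum
    -- once the cycles are joined, while the smaller one lo is below the
    -- whole joined cycle.
    record Ends : Set where
      field
        lo hi     : Fin n
        lo<hi     : lo <ᶠ hi
        hi-min    : IsMin v hi
        hi-lo     : Merged hi lo
        onlyEnds  : ∀ i → IsMin v i → Touches v a b i → i ≡ lo ⊎ i ≡ hi
        lo-least  : ∀ j → Touches v a b j → lo ≤ᶠ j

    ends : Ends
    ends with FP.<-cmp ma mb
    ... | tri< ma<mb _ _ = record
      { lo = ma ; hi = mb ; lo<hi = ma<mb ; hi-min = mb-min
      ; hi-lo = inj₂ (inj₂ (sameCycle-sym v b~mb) , inj₁ (sameCycle-sym v a~ma))
      ; onlyEnds = touching-min
      ; lo-least = λ { j (inj₁ c) → ma-least j c ; j (inj₂ c) → FP.≤-trans (NP.<⇒≤ ma<mb) (mb-least j c) } }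
    ... | tri≈ _ e _ = ⊥-elim (ma≢mb e)
    ... | tri> _ _ mb<ma = record
      { lo = mb ; hi = ma ; lo<hi = mb<ma ; hi-min = ma-min
      ; hi-lo = inj₂ (inj₁ (sameCycle-sym v a~ma) , inj₂ (sameCycle-sym v b~mb))
      ; onlyEnds = λ i mi t → swap (touching-min i mi t)
      ; lo-least = λ { j (inj₁ c) → FP.≤-trans (NP.<⇒≤ mb<ma) (ma-least j c) ; j (inj₂ c) → mb-least j c } }

    open Ends ends

    u-min⇒v-min : ∀ {i} → IsMin u i → IsMin v i
    u-min⇒v-min m j c = m j (coarser c)

    u-min⇒≢hi : ∀ {i} → IsMin u i → i ≢ hi
    u-min⇒≢hi m refl = NP.<⇒≱ lo<hi (m lo (merged⇒sameCycle hi-lo))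

    v-min⇒u-min : ∀ {i} → IsMin v i → i ≢ hi → IsMin u i
    v-min⇒u-min {i} m i≢hi j c with onlyJoin c
    ... | inj₁ c′ = m j c′
    ... | inj₂ (ti , tj) with onlyEnds i m ti
    ...   | inj₁ refl = lo-least j tj
    ...   | inj₂ e    = ⊥-elim (i≢hi e)

    minima-count : ∀ i → ind (isMin? v i) ≡ ind (isMin? u i) + ind (i FP.≟ hi)
    minima-count i with isMin? v i | isMin? u i | i FP.≟ hi
    ... | yes _   | yes mu  | yes e    = ⊥-elim (u-min⇒≢hi mu e)
    ... | yes _   | yes _   | no _     = refl
    ... | yes _   | no _    | yes _    = refl
    ... | yes mv  | no ¬mu  | no i≢hi  = ⊥-elim (¬mu (v-min⇒u-min mv i≢hi))
    ... | no ¬mv  | yes mu  | _        = ⊥-elim (¬mv (u-min⇒v-min mu))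
    ... | no ¬mv  | no _    | yes refl = ⊥-elim (¬mv hi-min)
    ... | no _    | no _    | no _     = refl

    cyc-join : cyc v ≡ suc (cyc u)
    cyc-join = begin
      cyc v                                                   ≡⟨ cyc-sum v ⟩
      sum (λ i → ind (isMin? v i))                            ≡⟨ sum-cong-≗ minima-count ⟩
      sum (λ i → ind (isMin? u i) + ind (i FP.≟ hi))          ≡⟨ ∑-distrib-+ (λ i → ind (isMin? u i)) (λ i → ind (i FP.≟ hi)) ⟩
      sum (λ i → ind (isMin? u i)) + sum (λ i → ind (i FP.≟ hi)) ≡⟨ cong₂ _+_ (sym (cyc-sum u)) (sum-δ hi) ⟩
      cyc u + 1                                               ≡⟨ NP.+-comm (cyc u) 1 ⟩
      suc (cyc u)                                             ∎

    joins : Joins v u a b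
    joins = record { apart = apart ; together = together ; coarser = coarser ; onlyJoin = onlyJoin ; cyc-join = cyc-join }

-- Composing with a transposition (a b) either joins the cycles of a and b
-- or, read backwards, splits their common cycle; so cyc changes by one.
transposition-dichotomy : ∀ {n} (v u : Perm n) a b → a ≢ b → u ≈ transpose a b ∘ₚ v → Joins v u a b ⊎ Joins u v a b
transposition-dichotomy v u a b a≢b u≈ with sameCycle? v a b
... | no apart = inj₁ (Surgery.Join.joins v u a b a≢b u≈ apart)
... | yes ab   = inj₂ (Surgery.Join.joins u v a b a≢b v≈ (Surgery.separated v u a b a≢b u≈ ab))
  where
  v≈ : v ≈ transpose a b ∘ₚ u
  v≈ y = trans (cong (v ⟨$⟩ʳ_) (sym (tr-involutive a b y))) (sym (u≈ (tr a b y)))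

-- Splitting a moved point x off its cycle: with w = v⁻¹ x, the
-- permutation u = (x w)·v fixes x, and v is obtained back from u by
-- joining the cycles of x and w.
record SplitOff {n} (v : Perm n) (x : Fin n) : Set where
  field
    i j   : Fin n
    i<j   : i <ᶠ j
    fixes : (transpose i j ∘ₚ v) ⟨$⟩ʳ x ≡ x
    joins : Joins (transpose i j ∘ₚ v) v x (v ⟨$⟩ˡ x)

split-off : ∀ {n} (v : Perm n) x → v ⟨$⟩ʳ x ≢ x → SplitOff v x
split-off v x moved = viaOrdered (ordered-transposition x≢w)
  where
  w = v ⟨$⟩ˡ x
  x≢w : x ≢ w
  x≢w e = moved (trans (cong (v ⟨$⟩ʳ_) e) (inverseʳ v))
  viaOrdered : (∃ λ i → ∃ λ j → i <ᶠ j × transpose i j ≈ transpose x w) → SplitOff v x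
  viaOrdered (i , j , i<j , t≈) with transposition-dichotomy v (transpose i j ∘ₚ v) x w x≢w (λ y → cong (v ⟨$⟩ʳ_) (t≈ y))
  ... | inj₁ J = ⊥-elim (Joins.apart J (sameCycle-sym v (1 , inverseʳ v)))
  ... | inj₂ J = record
    { i = i ; j = j ; i<j = i<j ; joins = J
    ; fixes = trans (cong (v ⟨$⟩ʳ_) (trans (t≈ x) (tr-a x w))) (inverseʳ v) }

inv-term : ∀ {n} → Perm n → Fin n → Fin n → ℕ
inv-term v i j = ind (v ⟨$⟩ʳ j FP.<? v ⟨$⟩ʳ i) * ind (i FP.<? j)

Inv : ∀ {n} → Perm n → ℕ
Inv v = sum (λ i → sum (λ j → inv-term v i j))

listSum : ∀ {a} {A : Set a} → (A → ℕ) → List A → ℕ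
listSum h = foldr (λ x acc → h x + acc) 0

length-filter-filter : ∀ {a p q} {A : Set a} {P : A → Set p} {Q : A → Set q} (P? : ∀ x → Dec (P x)) (Q? : ∀ x → Dec (Q x)) xs →
  length (filter Q? (filter P? xs)) ≡ listSum (λ x → ind (P? x) * ind (Q? x)) xs
length-filter-filter P? Q? [] = refl
length-filter-filter P? Q? (x ∷ xs) with P? x
... | no _ = length-filter-filter P? Q? xs
... | yes _ with Q? x
...   | yes _ = cong suc (length-filter-filter P? Q? xs)
...   | no _  = length-filter-filter P? Q? xs

listSum-++ : ∀ {a} {A : Set a} (h : A → ℕ) xs ys → listSum h (xs ++ ys) ≡ listSum h xs + listSum h ys
listSum-++ h []       ys = refl
listSum-++ h (x ∷ xs) ys = trans (cong (h x +_) (listSum-++ h xs ys)) (sym (NP.+-assoc (h x) _ _))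

listSum-concatMap : ∀ {a b} {A : Set a} {B : Set b} (h : B → ℕ) (f : A → List B) xs →
  listSum h (concatMap f xs) ≡ listSum (λ x → listSum h (f x)) xs
listSum-concatMap h f []       = refl
listSum-concatMap h f (x ∷ xs) = trans (listSum-++ h (f x) (concatMap f xs)) (cong (listSum h (f x) +_) (listSum-concatMap h f xs))

listSum-map : ∀ {a b} {A : Set a} {B : Set b} (h : B → ℕ) (g : A → B) xs → listSum h (map g xs) ≡ listSum (λ x → h (g x)) xs
listSum-map h g []       = refl
listSum-map h g (x ∷ xs) = cong (h (g x) +_) (listSum-map h g xs)

listSum-tabulate : ∀ {a} {A : Set a} (h : A → ℕ) {n} (f : Fin n → A) → listSum h (tabulate f) ≡ sum (λ i → h (f i))
listSum-tabulate h {zero}  f = refl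
listSum-tabulate h {suc n} f = cong (h (f f0) +_) (listSum-tabulate h (λ i → f (fs i)))

listSum-cong : ∀ {a} {A : Set a} {h g : A → ℕ} → (∀ x → h x ≡ g x) → ∀ xs → listSum h xs ≡ listSum g xs
listSum-cong e []       = refl
listSum-cong e (x ∷ xs) = cong₂ _+_ (e x) (listSum-cong e xs)

inversions≡Inv : ∀ {n} (v : Perm n) → inversions v ≡ Inv v
inversions≡Inv {n} v = begin
  inversions v
    ≡⟨ length-filter-filter (λ p → v ⟨$⟩ʳ proj₂ p FP.<? v ⟨$⟩ʳ proj₁ p) (λ p → proj₁ p FP.<? proj₂ p) (allPairs n) ⟩
  listSum h (allPairs n)
    ≡⟨ listSum-concatMap h row (allFin n) ⟩
  listSum (λ i → listSum h (row i)) (allFin n)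
    ≡⟨ listSum-cong (λ i → trans (listSum-map h (i ,_) (allFin n)) (listSum-tabulate (λ j → h (i , j)) (λ j → j))) (allFin n) ⟩
  listSum (λ i → sum (λ j → h (i , j))) (allFin n)
    ≡⟨ listSum-tabulate (λ i → sum (λ j → h (i , j))) (λ i → i) ⟩
  Inv v ∎
  where
  h : Fin n × Fin n → ℕ
  h (i , j) = inv-term v i j
  row : Fin n → List (Fin n × Fin n)
  row i = map (i ,_) (allFin n)

module AdjacentSwap {n} (v : Perm n) (a b : Fin n) (adj : toℕ b ≡ suc (toℕ a)) (desc : v ⟨$⟩ʳ b <ᶠ v ⟨$⟩ʳ a) where

  u : Perm n
  u = transpose a b ∘ₚ v

  t : Fin n → Fin n
  t = tr a b

  a<b : a <ᶠ b
  a<b = NP.≤-reflexive (sym adj)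

  a≢b : a ≢ b
  a≢b = FP.<⇒≢ a<b

  t-monotone : ∀ x y → ¬ (x ≡ a × y ≡ b) → ¬ (x ≡ b × y ≡ a) → x <ᶠ y → t x <ᶠ t y
  t-monotone x y not-ab not-ba x<y = byCases (x FP.≟ a) (x FP.≟ b) (y FP.≟ a) (y FP.≟ b)
    where
    byCases : Dec (x ≡ a) → Dec (x ≡ b) → Dec (y ≡ a) → Dec (y ≡ b) → t x <ᶠ t y
    byCases (yes refl) _          (yes refl) _          = ⊥-elim (NP.<-irrefl refl x<y)
    byCases (yes refl) _          (no _)     (yes refl) = ⊥-elim (not-ab (refl , refl))
    byCases (yes refl) _          (no y≢a)   (no y≢b)   = subst₂ _<ᶠ_ (sym (tr-a a b)) (sym (tr-other a b y y≢a y≢b))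
      (NP.≤∧≢⇒< (subst (_≤ℕ toℕ y) (sym adj) x<y) (λ e → y≢b (FP.toℕ-injective (sym e))))
    byCases (no _)     (yes refl) (yes refl) _          = ⊥-elim (not-ba (refl , refl))
    byCases (no _)     (yes refl) (no _)     (yes refl) = ⊥-elim (NP.<-irrefl refl x<y)
    byCases (no _)     (yes refl) (no y≢a)   (no y≢b)   = subst₂ _<ᶠ_ (sym (tr-b a b)) (sym (tr-other a b y y≢a y≢b)) (NP.<-trans a<b x<y)
    byCases (no x≢a)   (no x≢b)   (yes refl) _          = subst₂ _<ᶠ_ (sym (tr-other a b x x≢a x≢b)) (sym (tr-a a b)) (NP.<-trans x<y a<b)
    byCases (no x≢a)   (no x≢b)   (no _)     (yes refl) = subst₂ _<ᶠ_ (sym (tr-other a b x x≢a x≢b)) (sym (tr-b a b))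
      (NP.≤∧≢⇒< (NP.≤-pred (subst (toℕ x <ℕ_) adj x<y)) (λ e → x≢a (FP.toℕ-injective e)))
    byCases (no x≢a)   (no x≢b)   (no y≢a)   (no y≢b)   = subst₂ _<ᶠ_ (sym (tr-other a b x x≢a x≢b)) (sym (tr-other a b y y≢a y≢b)) x<y

  t≡a : ∀ {x} → t x ≡ a → x ≡ b
  t≡a {x} e = trans (sym (tr-involutive a b x)) (trans (cong t e) (tr-a a b))

  t≡b : ∀ {x} → t x ≡ b → x ≡ a
  t≡b {x} e = trans (sym (tr-involutive a b x)) (trans (cong t e) (tr-b a b))

  order-kept : ∀ i j → ¬ (i ≡ a × j ≡ b) → ¬ (i ≡ b × j ≡ a) → ind (i FP.<? j) ≡ ind (t i FP.<? t j)
  order-kept i j not-ab not-ba = ind-⇔ (i FP.<? j) (t i FP.<? t j) (t-monotone i j not-ab not-ba) reflect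
    where
    reflect : t i <ᶠ t j → i <ᶠ j
    reflect lt = subst₂ _<ᶠ_ (tr-involutive a b i) (tr-involutive a b j)
      (t-monotone (t i) (t j) (λ { (e₁ , e₂) → not-ba (t≡a e₁ , t≡b e₂) }) (λ { (e₁ , e₂) → not-ab (t≡b e₁ , t≡a e₂) }) lt)

  -- Relative to the order transported by t, the only inversion of v that
  -- changes is the descent (a , b) itself.
  inv-term-split : ∀ i j → inv-term v i j ≡ ind (v ⟨$⟩ʳ j FP.<? v ⟨$⟩ʳ i) * ind (t i FP.<? t j) + ind (i FP.≟ a) * ind (j FP.≟ b)
  inv-term-split i j = byCases (i FP.≟ a) (j FP.≟ b) (i FP.≟ b) (j FP.≟ a)
    where
    c : ℕ
    c = ind (v ⟨$⟩ʳ j FP.<? v ⟨$⟩ʳ i)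
    kept : ∀ {x y} → x ≡ y → c * x ≡ c * y + 0
    kept {x} e = trans (cong (c *_) e) (sym (NP.+-identityʳ _))
    reversed : c ≡ 0 → ∀ {x y} → c * x ≡ c * y + 0
    reversed e {x} {y} = trans (cong (_* x) e) (sym (cong (λ c′ → c′ * y + 0) e))
    byCases : (da : Dec (i ≡ a)) (db : Dec (j ≡ b)) → Dec (i ≡ b) → Dec (j ≡ a) →
              c * ind (i FP.<? j) ≡ c * ind (t i FP.<? t j) + ind da * ind db
    byCases (yes refl) (yes refl) _ _ = begin
      c * ind (a FP.<? b)          ≡⟨ cong₂ _*_ (ind-yes (v ⟨$⟩ʳ b FP.<? v ⟨$⟩ʳ a) desc) (ind-yes (a FP.<? b) a<b) ⟩
      1                            ≡⟨ cong (_+ 1) (sym (NP.*-zeroʳ c)) ⟩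
      c * 0 + 1                    ≡⟨ cong (λ x → c * x + 1) (sym (ind-no (t a FP.<? t b) tb≮ta)) ⟩
      c * ind (t a FP.<? t b) + 1  ∎
      where
      tb≮ta : ¬ (t a <ᶠ t b)
      tb≮ta lt = NP.<-asym a<b (subst₂ _<ᶠ_ (tr-a a b) (tr-b a b) lt)
    byCases (yes refl) (no j≢b) _          _          = kept (order-kept i j (λ p → j≢b (proj₂ p)) (λ p → a≢b (proj₁ p)))
    byCases (no _)     _        (yes refl) (yes refl) = reversed (ind-no _ (NP.<-asym desc))
    byCases (no i≢a)   _        (yes refl) (no j≢a)   = kept (order-kept i j (λ p → i≢a (proj₁ p)) (λ p → j≢a (proj₂ p)))
    byCases (no i≢a)   _        (no i≢b)   _          = kept (order-kept i j (λ p → i≢a (proj₁ p)) (λ p → i≢b (proj₁ p)))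

  inv-descent : Inv v ≡ suc (Inv u)
  inv-descent = begin
    Inv v                                      ≡⟨ sum-cong-≗ (λ i → trans (sum-cong-≗ (inv-term-split i)) (∑-distrib-+ (A i) (B i))) ⟩
    sum (λ i → sum (A i) + sum (B i))          ≡⟨ ∑-distrib-+ (λ i → sum (A i)) (λ i → sum (B i)) ⟩
    sum (λ i → sum (A i)) + sum (λ i → sum (B i)) ≡⟨ cong₂ _+_ (sym reindex) sum-B ⟩
    Inv u + 1                                  ≡⟨ NP.+-comm (Inv u) 1 ⟩
    suc (Inv u)                                ∎
    where
    A B : Fin n → Fin n → ℕ
    A i j = ind (v ⟨$⟩ʳ j FP.<? v ⟨$⟩ʳ i) * ind (t i FP.<? t j)
    B i j = ind (i FP.≟ a) * ind (j FP.≟ b)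
    sum-B : sum (λ i → sum (B i)) ≡ 1
    sum-B = trans (sum-cong-≗ (λ i → trans (sym (*-distribˡ-sum (ind (i FP.≟ a)) (λ j → ind (j FP.≟ b))))
                                         (trans (cong (ind (i FP.≟ a) *_) (sum-δ b)) (NP.*-identityʳ _))))
                  (sum-δ a)
    -- substituting i ↦ t i, j ↦ t j turns the inversions of u into A
    reindex : Inv u ≡ sum (λ i → sum (A i))
    reindex = trans (sum-permute (λ i → sum (λ j → inv-term u i j)) (transpose a b))
      (sum-cong-≗ (λ i → trans (sum-permute (λ j → inv-term u (t i) j) (transpose a b))
        (sum-cong-≗ (λ j → cong (_* ind (t i FP.<? t j)) (ind-⇔ (_ FP.<? _) (_ FP.<? _)
          (subst₂ _<ᶠ_ (cong (v ⟨$⟩ʳ_) (tr-involutive a b j)) (cong (v ⟨$⟩ʳ_) (tr-involutive a b i)))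
          (subst₂ _<ᶠ_ (cong (v ⟨$⟩ʳ_) (sym (tr-involutive a b j))) (cong (v ⟨$⟩ʳ_) (sym (tr-involutive a b i)))))))))

  -- Inv drops by one and cyc changes by one, so Inv + cyc keeps its parity.
  parity-kept : parity (Inv v + cyc v) ≡ parity (Inv u + cyc u)
  parity-kept with transposition-dichotomy v u a b a≢b (λ _ → refl)
  ... | inj₁ J = cong parity (begin
    Inv v + cyc v                 ≡⟨ cong₂ _+_ inv-descent (Joins.cyc-join J) ⟩
    suc (Inv u) + suc (cyc u)     ≡⟨ cong suc (NP.+-suc (Inv u) (cyc u)) ⟩
    suc (suc (Inv u + cyc u))     ∎)
  ... | inj₂ J = cong parity (begin
    Inv v + cyc v                 ≡⟨ cong (_+ cyc v) inv-descent ⟩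
    suc (Inv u) + cyc v           ≡⟨ sym (NP.+-suc (Inv u) (cyc v)) ⟩
    Inv u + suc (cyc v)           ≡⟨ cong (Inv u +_) (sym (Joins.cyc-join J)) ⟩
    Inv u + cyc u                 ∎)

Descent : ∀ {n} → Perm n → Set
Descent {n} v = ∃ λ (a : Fin n) → ∃ λ (b : Fin n) → toℕ b ≡ suc (toℕ a) × v ⟨$⟩ʳ b <ᶠ v ⟨$⟩ʳ a

descent? : ∀ {n} (v : Perm n) → Dec (Descent v)
descent? v = FP.any? (λ a → FP.any? (λ b → (toℕ b NP.≟ suc (toℕ a)) ×-dec (v ⟨$⟩ʳ b FP.<? v ⟨$⟩ʳ a)))

-- Without adjacent descents v is increasing, so v y ≥ y for all y;
-- as both sides sum to the same total, v is the identity.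
noDescent⇒identity : ∀ {n} (v : Perm n) → ¬ Descent v → ∀ x → v ⟨$⟩ʳ x ≡ x
noDescent⇒identity {n} v none x = sym (FP.toℕ-injective (sum-mono-tight (λ y → above (toℕ y) y refl) (sum-permute toℕ v) x))
  where
  ascends : ∀ a b → toℕ b ≡ suc (toℕ a) → v ⟨$⟩ʳ a <ᶠ v ⟨$⟩ʳ b
  ascends a b adj = NP.≤∧≢⇒< (NP.≮⇒≥ (λ d → none (a , b , adj , d)))
    (λ e → NP.1+n≢n (trans (sym adj) (cong toℕ (sym (perm-injective v (FP.toℕ-injective e))))))
  above : ∀ k y → toℕ y ≡ k → toℕ y ≤ℕ toℕ (v ⟨$⟩ʳ y)
  above zero    y e = subst (_≤ℕ toℕ (v ⟨$⟩ʳ y)) (sym e) z≤n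
  above (suc k) y e = subst (_≤ℕ toℕ (v ⟨$⟩ʳ y)) (sym y≡1+a) (NP.≤-trans (s≤s (above k a a≡k)) (ascends a y y≡1+a))
    where
    k<n : k <ℕ n
    k<n = subst (_≤ℕ n) e (NP.<⇒≤ (FP.toℕ<n y))
    a : Fin n
    a = fromℕ< k<n
    a≡k : toℕ a ≡ k
    a≡k = FP.toℕ-fromℕ< k<n
    y≡1+a : toℕ y ≡ suc (toℕ a)
    y≡1+a = trans e (cong suc (sym a≡k))

Inv-identity : ∀ {n} (v : Perm n) → (∀ x → v ⟨$⟩ʳ x ≡ x) → Inv v ≡ 0
Inv-identity v fixed = sum-zeros (λ i → sum-zeros (λ j → noInversion i j (i FP.<? j)))
  where
  noInversion : ∀ i j (d : Dec (i <ᶠ j)) → ind (v ⟨$⟩ʳ j FP.<? v ⟨$⟩ʳ i) * ind d ≡ 0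
  noInversion i j (yes i<j) = cong (_* 1) (ind-no (v ⟨$⟩ʳ j FP.<? v ⟨$⟩ʳ i) (λ lt → NP.<-asym i<j (subst₂ _<ᶠ_ (fixed j) (fixed i) lt)))
  noInversion i j (no _)    = NP.*-zeroʳ (ind (v ⟨$⟩ʳ j FP.<? v ⟨$⟩ʳ i))

parity-suc : ∀ k → parity (suc k) ≡ parity k ⁻¹
parity-suc k = sym (⁻¹-selfInverse (suc-homo-⁻¹ k))

parity-cyc-flip : ∀ {n} (v u : Perm n) a b → a ≢ b → u ≈ transpose a b ∘ₚ v → parity (cyc u) ≡ parity (cyc v) ⁻¹
parity-cyc-flip v u a b a≢b u≈ with transposition-dichotomy v u a b a≢b u≈
... | inj₁ J = trans (sym (suc-homo-⁻¹ (cyc u))) (cong (λ k → parity k ⁻¹) (sym (Joins.cyc-join J)))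
... | inj₂ J = trans (cong parity (Joins.cyc-join J)) (parity-suc (cyc v))

-- parity(Inv v + cyc v) = parity n, by induction on Inv v: removing an
-- adjacent descent lowers Inv by one and changes cyc by one.
parity-Inv+cyc : ∀ {n} (v : Perm n) → parity (Inv v + cyc v) ≡ parity n
parity-Inv+cyc v = byInv (Inv v) v refl
  where
  byInv : ∀ N {n} (v : Perm n) → Inv v ≡ N → parity (Inv v + cyc v) ≡ parity n
  byInv N {n} v e with descent? v
  ... | no none = cong parity (cong₂ _+_ (Inv-identity v fixed) (cyc-identity v fixed))
    where fixed = noDescent⇒identity v none
  ... | yes (a , b , adj , d) = descending N e
    where
    module S = AdjacentSwap v a b adj d
    descending : ∀ N → Inv v ≡ N → parity (Inv v + cyc v) ≡ parity n
    descending zero    e = ⊥-elim (NP.1+n≢0 (trans (sym S.inv-descent) e))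
    descending (suc N) e = trans S.parity-kept (byInv N S.u (NP.suc-injective (trans (sym S.inv-descent) e)))

even⇒parity-cyc : ∀ {n} (v : Perm n) → InAlt v → parity (cyc v) ≡ parity n
even⇒parity-cyc {n} v (divides q inv≡2q) = begin
  parity (cyc v)                  ≡⟨ sym (parity-double+ q (cyc v)) ⟩
  parity (q * 2 + cyc v)          ≡⟨ cong (λ k → parity (k + cyc v)) (trans (sym inv≡2q) (inversions≡Inv v)) ⟩
  parity (Inv v + cyc v)          ≡⟨ parity-Inv+cyc v ⟩
  parity n                        ∎
  where
  parity-double+ : ∀ q c → parity (q * 2 + c) ≡ parity c
  parity-double+ zero    c = refl
  parity-double+ (suc q) c = parity-double+ q c

fixes-or-moves : ∀ {k n} (v : Perm n) (S : Fin k → Fin n) → (∀ x → v ⟨$⟩ʳ S x ≡ S x) ⊎ ∃ λ x → v ⟨$⟩ʳ S x ≢ S x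
fixes-or-moves v S with FP.any? (λ x → ¬? (v ⟨$⟩ʳ S x FP.≟ S x))
... | yes moved = inj₂ moved
... | no none   = inj₁ (λ x → decidable-stable (v ⟨$⟩ʳ S x FP.≟ S x) (λ ne → none (x , ne)))

-- From here on n = 2 + m, with the points 1, 2 represented by f0, f1.
module _ {m : ℕ} where
  private
    n : ℕ
    n = suc (suc m)

  f1 : Fin n
  f1 = fs f0

  linked? : (v : Perm n) → Dec (SameCycle v f0 f1)
  linked? v = sameCycle? v f0 f1

  D : Perm n → ℕ
  D v = cyc v + ind (linked? v)

  D-unlinked : (v : Perm n) → ¬ SameCycle v f0 f1 → D v ≡ cyc v
  D-unlinked v apart = trans (cong (cyc v +_) (ind-no (linked? v) apart)) (NP.+-identityʳ (cyc v))

  D-linked : (v : Perm n) → SameCycle v f0 f1 → D v ≡ cyc v + 1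
  D-linked v linked = cong (cyc v +_) (ind-yes (linked? v) linked)

  D-cong : {v w : Perm n} → v ≈ w → D v ≡ D w
  D-cong {v} {w} e = cong₂ _+_ (cyc-cong e)
    (ind-⇔ (linked? v) (linked? w) (sameCycle-cong e) (sameCycle-cong (λ x → sym (e x))))

  D≤n : (v : Perm n) → D v ≤ℕ n
  D≤n v with linked? v
  ... | yes l = subst (_≤ℕ n) (NP.+-comm 1 (cyc v)) (s≤s (cyc<n v f1 (λ min → f1≰f0 (min f0 (sameCycle-sym v l)))))
    where
    f1≰f0 : ¬ (f1 ≤ᶠ f0 {suc m})
    f1≰f0 ()
  ... | no _  = subst (_≤ℕ n) (sym (NP.+-identityʳ (cyc v))) (cyc≤n v)

  cyc-fixing-tail : (v : Perm n) → (∀ x → v ⟨$⟩ʳ fs (fs x) ≡ fs (fs x)) → suc m ≤ℕ cyc v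
  cyc-fixing-tail v fixed = subst (suc m ≤ℕ_) (sym (cyc-sum v)) (NP.+-mono-≤ f0-min (NP.≤-trans tail-min (NP.m≤n+m _ _)))
    where
    f0-min : 1 ≤ℕ ind (isMin? v f0)
    f0-min = NP.≤-reflexive (sym (ind-yes (isMin? v f0) (λ _ _ → z≤n)))
    tail-min : m ≤ℕ sum (λ x → ind (isMin? v (fs (fs x))))
    tail-min = NP.≤-reflexive (trans (sym (sum-ones m))
      (sum-cong-≗ (λ x → sym (ind-yes (isMin? v _) (λ j c → FP.≤-reflexive (sameCycle-fixed v (fixed x) c))))))

  -- (1 2) moves 1, 2 between one and two cycles, so it preserves D.
  D-swap12 : (v u : Perm n) → u ≈ transpose f0 f1 ∘ₚ v → D u ≡ D v
  D-swap12 v u u≈ with transposition-dichotomy v u f0 f1 (λ ()) u≈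
  ... | inj₁ J = begin
    cyc u + ind (linked? u)  ≡⟨ cong (cyc u +_) (ind-yes (linked? u) (Joins.together J)) ⟩
    cyc u + 1                ≡⟨ NP.+-comm (cyc u) 1 ⟩
    suc (cyc u)              ≡⟨ sym (Joins.cyc-join J) ⟩
    cyc v                    ≡⟨ sym (NP.+-identityʳ (cyc v)) ⟩
    cyc v + 0                ≡⟨ cong (cyc v +_) (sym (ind-no (linked? v) (Joins.apart J))) ⟩
    cyc v + ind (linked? v)  ∎
  ... | inj₂ J = begin
    cyc u + ind (linked? u)  ≡⟨ cong₂ _+_ (Joins.cyc-join J) (ind-no (linked? u) (Joins.apart J)) ⟩
    suc (cyc v) + 0          ≡⟨ NP.+-comm (suc (cyc v)) 0 ⟩
    suc (cyc v)              ≡⟨ NP.+-comm 1 (cyc v) ⟩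
    cyc v + 1                ≡⟨ cong (cyc v +_) (sym (ind-yes (linked? v) (Joins.together J))) ⟩
    cyc v + ind (linked? v)  ∎

  D-transposition : (v u : Perm n) (a b : Fin n) → a ≢ b → u ≈ transpose a b ∘ₚ v → D v ≤ℕ suc (D u)
  D-transposition v u a b a≢b u≈ with transposition-dichotomy v u a b a≢b u≈
  ... | inj₁ J = subst (_≤ℕ suc (D u)) (cong (_+ ind (linked? v)) (sym (Joins.cyc-join J)))
                   (s≤s (NP.+-monoʳ-≤ (cyc u) (ind-mono (linked? v) (linked? u) (Joins.coarser J))))
  ... | inj₂ J = NP.≤-trans (NP.+-monoʳ-≤ (cyc v) (ind≤1 (linked? v)))
                   (NP.≤-trans (NP.≤-reflexive (trans (NP.+-comm (cyc v) 1) (sym (Joins.cyc-join J))))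
                               (NP.≤-trans (NP.m≤m+n (cyc u) _) (NP.n≤1+n _)))

  D-generator : ∀ i j (w : List (Fin n × Fin n)) → i <ᶠ j → D (prod w) ≤ℕ suc (D (prod ((i , j) ∷ w)))
  D-generator i j w i<j = subst (λ d → D (prod w) ≤ℕ suc d) (sym (D-swap12 Y (prod ((i , j) ∷ w)) (λ _ → refl)))
    (D-transposition (prod w) Y i j (FP.<⇒≢ i<j) (λ _ → refl))
    where
    Y : Perm n
    Y = transpose i j ∘ₚ prod w

  -- Since D(id) = n, every word w satisfies n ≤ D (prod w) + length w.
  D-word : (w : List (Fin n × Fin n)) → All (λ p → proj₁ p <ᶠ proj₂ p) w → n ≤ℕ D (prod w) + length w
  D-word [] [] = NP.≤-trans (NP.≤-reflexive (sym (cyc-identity (id {n}) (λ _ → refl)))) (NP.≤-trans (NP.m≤m+n _ _) (NP.m≤m+n _ 0))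
  D-word ((i , j) ∷ w) (i<j ∷ ordered) = NP.≤-trans (D-word w ordered)
    (NP.≤-trans (NP.+-monoˡ-≤ (length w) (D-generator i j w i<j))
                (NP.≤-reflexive (sym (NP.+-suc (D (prod ((i , j) ∷ w))) (length w)))))

  length-lower : (v : Perm n) → ∀ k → ProductOfT v k → n ∸ D v ≤ℕ k
  length-lower v k (w , len , ordered , w≈v) =
    NP.m≤n+o⇒m∸n≤o n (D v) (subst (n ≤ℕ_) (cong₂ _+_ (D-cong w≈v) len) (D-word w ordered))

  D-split : {u v : Perm n} {x w : Fin n} → Joins u v x w → (SameCycle v f0 f1 → SameCycle u f0 f1) → D u ≡ suc (D v)
  D-split {u} {v} J keepLinked = cong₂ _+_ (Joins.cyc-join J) (ind-⇔ (linked? u) (linked? v) (Joins.coarser J) keepLinked)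

  -- If D v < n, some transposition (i j), i < j, raises D by one: split a
  -- moved point off its cycle, choosing it different from 1 and 2 when
  -- these are linked, so that their common cycle stays intact.
  raise-D : (v : Perm n) → D v <ℕ n → ∃ λ i → ∃ λ j → i <ᶠ j × D (transpose i j ∘ₚ v) ≡ suc (D v)
  raise-D v D<n = byLinked (linked? v)
    where
    result : ∀ {x} (S : SplitOff v x) → (SameCycle v f0 f1 → SameCycle (transpose (SplitOff.i S) (SplitOff.j S) ∘ₚ v) f0 f1) →
             ∃ λ i → ∃ λ j → i <ᶠ j × D (transpose i j ∘ₚ v) ≡ suc (D v)
    result S keepLinked = SplitOff.i S , SplitOff.j S , SplitOff.i<j S , D-split (SplitOff.joins S) keepLinked
    byLinked : Dec (SameCycle v f0 f1) → ∃ λ i → ∃ λ j → i <ᶠ j × D (transpose i j ∘ₚ v) ≡ suc (D v)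
    byLinked (no apart) with fixes-or-moves v (λ x → x)
    ... | inj₁ fixed       = ⊥-elim (NP.<⇒≱ D<n (subst (_≤ℕ D v) (cyc-identity v fixed) (NP.m≤m+n (cyc v) _)))
    ... | inj₂ (x , moved) = result (split-off v x moved) (λ l → ⊥-elim (apart l))
    byLinked (yes linked) with fixes-or-moves v (λ x → fs (fs x))
    ... | inj₁ fixed       = ⊥-elim (NP.<⇒≱ D<n (NP.≤-trans (NP.≤-reflexive (NP.+-comm 1 (suc m)))
                               (NP.≤-trans (NP.+-monoˡ-≤ 1 (cyc-fixing-tail v fixed))
                                           (NP.≤-reflexive (cong (cyc v +_) (sym (ind-yes (linked? v) linked)))))))
    ... | inj₂ (x , moved) = result S keepLinked
      where
      S : SplitOff v (fs (fs x))
      S = split-off v (fs (fs x)) moved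
      u : Perm n
      u = transpose (SplitOff.i S) (SplitOff.j S) ∘ₚ v
      -- 1 and 2 cannot lie in the cycle of the split-off fixed point
      nearW : ∀ p → p ≢ fs (fs x) → Touches u (fs (fs x)) (v ⟨$⟩ˡ fs (fs x)) p → SameCycle u p (v ⟨$⟩ˡ fs (fs x))
      nearW p p≢x (inj₁ c) = ⊥-elim (p≢x (sym (sameCycle-fixed u (SplitOff.fixes S) (sameCycle-sym u c))))
      nearW p _   (inj₂ c) = c
      keepLinked : SameCycle v f0 f1 → SameCycle u f0 f1
      keepLinked l = fromMerged (Joins.onlyJoin (SplitOff.joins S) l)
        where
        fromMerged : SameCycle u f0 f1 ⊎ (Touches u (fs (fs x)) (v ⟨$⟩ˡ fs (fs x)) f0 × Touches u (fs (fs x)) (v ⟨$⟩ˡ fs (fs x)) f1) → SameCycle u f0 f1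
        fromMerged (inj₁ c)         = c
        fromMerged (inj₂ (t₀ , t₁)) = sameCycle-trans u (nearW f0 (λ ()) t₀) (sameCycle-sym u (nearW f1 (λ ()) t₁))

  -- With D v = n, the parity of cyc v excludes the linked case, so cyc v = n.
  D≡n⇒identity : (v : Perm n) → parity (cyc v) ≡ parity n → D v ≡ n → ∀ x → v ⟨$⟩ʳ x ≡ x
  D≡n⇒identity v par D≡n = cyc≡n⇒identity v (byLinked (linked? v) refl)
    where
    byLinked : (d : Dec (SameCycle v f0 f1)) → ind (linked? v) ≡ ind d → cyc v ≡ n
    byLinked (yes _) ind≡1 = ⊥-elim (p≢p⁻¹ (parity n) (begin
      parity n             ≡⟨ cong parity (sym (trans (cong (cyc v +_) (sym ind≡1)) D≡n)) ⟩
      parity (cyc v + 1)   ≡⟨ cong parity (NP.+-comm (cyc v) 1) ⟩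
      parity (suc (cyc v)) ≡⟨ parity-suc (cyc v) ⟩
      parity (cyc v) ⁻¹    ≡⟨ cong _⁻¹ par ⟩
      parity n ⁻¹          ∎))
    byLinked (no _)  ind≡0 = trans (sym (NP.+-identityʳ (cyc v))) (trans (cong (cyc v +_) (sym ind≡0)) D≡n)

  -- Upper bound, by induction on N = n ∸ D v: write v = (1 2)(i j) v′
  -- where v′ = (i j)(1 2) v has D v′ = D v + 1 and the same parity of cyc.
  length-upper : ∀ N (v : Perm n) → parity (cyc v) ≡ parity n → D v + N ≡ n → ProductOfT v N
  length-upper zero    v par D+0≡n = [] , refl , [] , (λ x → sym (D≡n⇒identity v par (trans (sym (NP.+-identityʳ (D v))) D+0≡n) x))
  length-upper (suc N) v par D+N≡n = extend (raise-D τv (subst (_<ℕ n) (sym D-τv) D<n))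
    where
    τv : Perm n
    τv = transpose f0 f1 ∘ₚ v
    D-τv : D τv ≡ D v
    D-τv = D-swap12 v τv (λ _ → refl)
    D<n : D v <ℕ n
    D<n = NP.≤-trans (NP.m<m+n (D v) (s≤s z≤n)) (NP.≤-reflexive D+N≡n)
    extend : (∃ λ i → ∃ λ j → i <ᶠ j × D (transpose i j ∘ₚ τv) ≡ suc (D τv)) → ProductOfT v (suc N)
    extend (i , j , i<j , raised) = prepend (length-upper N v′ par′ D′+N≡n)
      where
      v′ : Perm n
      v′ = transpose i j ∘ₚ τv
      par′ : parity (cyc v′) ≡ parity n
      par′ = begin
        parity (cyc v′)         ≡⟨ parity-cyc-flip τv v′ i j (FP.<⇒≢ i<j) (λ _ → refl) ⟩
        parity (cyc τv) ⁻¹      ≡⟨ cong _⁻¹ (parity-cyc-flip v τv f0 f1 (λ ()) (λ _ → refl)) ⟩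
        parity (cyc v) ⁻¹ ⁻¹    ≡⟨ ⁻¹-involutive (parity (cyc v)) ⟩
        parity (cyc v)          ≡⟨ par ⟩
        parity n                ∎
      D′+N≡n : D v′ + N ≡ n
      D′+N≡n = begin
        D v′ + N                ≡⟨ cong (_+ N) (trans raised (cong suc D-τv)) ⟩
        suc (D v) + N           ≡⟨ sym (NP.+-suc (D v) N) ⟩
        D v + suc N             ≡⟨ D+N≡n ⟩
        n                       ∎
      -- (1 2)(i j) v′ = (1 2)(i j)(i j)(1 2) v = v
      prepend : ProductOfT v′ N → ProductOfT v (suc N)
      prepend (w , len , ordered , w≈v′) = (i , j) ∷ w , cong suc len , i<j ∷ ordered ,
        (λ x → trans (w≈v′ _) (cong (v ⟨$⟩ʳ_) (trans (cong (tr f0 f1) (tr-involutive i j (tr f0 f1 x))) (tr-involutive f0 f1 x))))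

  length-formula : (v : Perm n) → parity (cyc v) ≡ parity n → LengthT v (n ∸ D v)
  length-formula v par = length-upper (n ∸ D v) v par (NP.m+[n∸m]≡n (D≤n v)) , length-lower v

corollary6p4 : ∀ (m : ℕ) (v : Perm (suc (suc m))) → InAlt v →
    (¬ SameCycle v f0 (fs f0) → LengthT v (suc (suc m) ∸ cyc v)) ×
    (SameCycle v f0 (fs f0) → LengthT v (suc (suc m) ∸ cyc v ∸ 1))
corollary6p4 m v even =
    (λ apart  → subst (LengthT v) (cong (n ∸_) (D-unlinked v apart)) ℓ)
  , (λ linked → subst (LengthT v) (trans (cong (n ∸_) (D-linked v linked)) (sym (NP.∸-+-assoc n (cyc v) 1))) ℓ)
  where
  n : ℕ
  n = suc (suc m)
  ℓ : LengthT v (n ∸ D v)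
  ℓ = length-formula v (even⇒parity-cyc v even)
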